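{- Let $\mathrm{M}$ be a matroid. For a flat $F$, let $A^{\bullet}(\mathrm{M})_F$ be the $\mathbb{Z}$-span in $A^{\bullet}(\mathrm{M})$ of the monomials $h_{G_1}^{a_1} \dotsb h_{G_k}^{a_k}$ with $G_1 \vee \dotsb \vee G_k = F$ (the empty monomial $1$ having join $\emptyset$). Then $$A^{\bullet}(\mathrm{M}) = \bigoplus_{F \in \mathcal{L}_{\mathrm{M}}} A^{\bullet}(\mathrm{M})_F.$$
   Context: A matroid $\mathrm{M}$ is a finite nonempty atomic ranked lattice $\mathcal{L}_{\mathrm{M}}$ (every element is the join of the atoms below it; every maximal chain in $[\emptyset, F]$ has length $\operatorname{rk}(F)$) whose rank function $\operatorname{rk}$ is submodular; elements are flats, minimal flat $\emptyset$. Let $\overline{\mathcal{L}}_{\mathrm{M}} = \mathcal{L}_{\mathrm{M}} \setminus \{\emptyset\}$. The augmented Chow ring $A^{\bullet}(\mathrm{M})$ is the quotient of $\mathbb{Z}[h_F]_{F \in \overline{\mathcal{L}}_{\mathrm{M}}}$ by $((h_{F} - h_{G \vee F})(h_G - h_{G \vee F}) : F, G \in \overline{\mathcal{L}}_{\mathrm{M}}) + (h_a^2,\ h_ah_F - h_ah_{F \vee a} : F \in \overline{\mathcal{L}}_{\mathrm{M}},\ a \text{ atom})$. -}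

module Defs where

open import Data.Nat using (ℕ; zero; suc) renaming (_+_ to _+ℕ_; _≤_ to _≤ℕ_)
open import Data.Integer using (ℤ) renaming (_+_ to _+ℤ_; _*_ to _*ℤ_)
open import Data.Product using (Σ; _×_; _,_; proj₁; proj₂)
open import Data.Sum using (_⊎_)
open import Data.List using (List; []; _∷_; foldr)
open import Data.List.Membership.Propositional using (_∈_)
open import Data.List.Relation.Unary.All using (All)
open import Data.List.Relation.Unary.Unique.Propositional using (Unique)
open import Relation.Nullary using (¬_)
open import Relation.Nullary.Decidable using (False; fromWitnessFalse; toWitnessFalse)
open import Relation.Binary.PropositionalEquality using (_≡_; _≢_; refl; sym; trans; subst)
open import Relation.Binary.Definitions using (DecidableEquality; Minimum)
open import Relation.Binary.Structures using (IsPartialOrder)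
open import Relation.Binary.Lattice.Structures using (IsLattice)

module PosetNotions {Flat : Set} (_≤_ : Flat → Flat → Set) (∅ : Flat) where

  infix 4 _⋖_

  _⋖_ : Flat → Flat → Set
  F ⋖ G = F ≤ G × F ≢ G × (∀ H → F ≤ H → H ≤ G → H ≡ F ⊎ H ≡ G)

  Atom : Flat → Set
  Atom a = ∅ ⋖ a

  data MaxChain : Flat → ℕ → Set where
    start : MaxChain ∅ zero
    step  : ∀ {F G k} → MaxChain F k → F ⋖ G → MaxChain G (suc k)

-- Matroids as finite atomic ranked lattices with submodular rank.

record Matroid : Set₁ where
  infixr 6 _∨_
  infixr 7 _∧_
  infix 4 _≤_
  field
    Flat      : Set
    _≟_       : DecidableEquality Flat
    flats     : List Flat
    flats-complete : ∀ F → F ∈ flats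
    flats-unique   : Unique flats
    _≤_       : Flat → Flat → Set
    _∨_       : Flat → Flat → Flat
    _∧_       : Flat → Flat → Flat
    isLattice : IsLattice _≡_ _≤_ _∨_ _∧_
    ∅         : Flat
    ∅-minimum : Minimum _≤_ ∅

  open PosetNotions _≤_ ∅ public

  field
    rk        : Flat → ℕ
    -- atomic: every flat is the join (least upper bound) of the atoms below it
    atomic    : ∀ F G → (∀ a → Atom a → a ≤ F → a ≤ G) → F ≤ G
    ranked    : ∀ F k → MaxChain F k → k ≡ rk F
    submodular : ∀ F G → rk (F ∨ G) +ℕ rk (F ∧ G) ≤ℕ rk F +ℕ rk G

  NonEmpty : Flat → Set
  NonEmpty F = False (F ≟ ∅)

  L̄ : Set
  L̄ = Σ Flat NonEmpty

  private
    module IL = IsLattice isLattice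
    module PO = IsPartialOrder IL.isPartialOrder

  ≤∅⇒≡∅ : ∀ {F} → F ≤ ∅ → F ≡ ∅
  ≤∅⇒≡∅ {F} p = PO.antisym p (∅-minimum F)

  ∨-nonEmpty : ∀ F G → NonEmpty F → NonEmpty (F ∨ G)
  ∨-nonEmpty F G ne = fromWitnessFalse λ eq →
    toWitnessFalse ne (≤∅⇒≡∅ (subst (F ≤_) eq (proj₁ (IL.supremum F G))))

  atom-nonEmpty : ∀ a → Atom a → NonEmpty a
  atom-nonEmpty a (_ , a≢ , _) = fromWitnessFalse λ eq → a≢ (sym eq)

  _∨̄_ : L̄ → Flat → L̄
  (F , ne) ∨̄ G = (F ∨ G) , ∨-nonEmpty F G ne

  atom : (a : Flat) → Atom a → L̄
  atom a at = a , atom-nonEmpty a at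

  joinW : List L̄ → Flat
  joinW = foldr (λ v acc → proj₁ v ∨ acc) ∅

-- Polynomial expressions over ℤ in variables from V, and the commutative
-- ring presented by generators V and relations R (i.e. ℤ[V] / (R)).

infixl 6 _⊕_
infixl 7 _⊗_
infix 8 ⊖_

data Poly (V : Set) : Set where
  var : V → Poly V
  con : ℤ → Poly V
  _⊕_ : Poly V → Poly V → Poly V
  _⊗_ : Poly V → Poly V → Poly V
  ⊖_  : Poly V → Poly V

_⊝_ : ∀ {V} → Poly V → Poly V → Poly V
p ⊝ q = p ⊕ ⊖ q

data Cong {V : Set} (R : Poly V → Set) : Poly V → Poly V → Set where
  ≈-refl  : ∀ {p} → Cong R p p
  ≈-sym   : ∀ {p q} → Cong R p q → Cong R q p
  ≈-trans : ∀ {p q r} → Cong R p q → Cong R q r → Cong R p r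
  ⊕-cong  : ∀ {p p′ q q′} → Cong R p p′ → Cong R q q′ → Cong R (p ⊕ q) (p′ ⊕ q′)
  ⊗-cong  : ∀ {p p′ q q′} → Cong R p p′ → Cong R q q′ → Cong R (p ⊗ q) (p′ ⊗ q′)
  ⊖-cong  : ∀ {p p′} → Cong R p p′ → Cong R (⊖ p) (⊖ p′)
  ⊕-assoc : ∀ p q r → Cong R ((p ⊕ q) ⊕ r) (p ⊕ (q ⊕ r))
  ⊕-comm  : ∀ p q → Cong R (p ⊕ q) (q ⊕ p)
  ⊕-idˡ   : ∀ p → Cong R (con (ℤ.pos 0) ⊕ p) p
  ⊖-invˡ  : ∀ p → Cong R (⊖ p ⊕ p) (con (ℤ.pos 0))
  ⊗-assoc : ∀ p q r → Cong R ((p ⊗ q) ⊗ r) (p ⊗ (q ⊗ r))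
  ⊗-comm  : ∀ p q → Cong R (p ⊗ q) (q ⊗ p)
  ⊗-idˡ   : ∀ p → Cong R (con (ℤ.pos 1) ⊗ p) p
  distribˡ : ∀ p q r → Cong R (p ⊗ (q ⊕ r)) ((p ⊗ q) ⊕ (p ⊗ r))
  con-+   : ∀ m n → Cong R (con (m +ℤ n)) (con m ⊕ con n)
  con-*   : ∀ m n → Cong R (con (m *ℤ n)) (con m ⊗ con n)
  relator : ∀ {p} → R p → Cong R p (con (ℤ.pos 0))

module AugmentedChow (M : Matroid) where
  open Matroid M

  h : L̄ → Poly L̄
  h = var

  data Relator : Poly L̄ → Set where
    rel-join  : (F G : L̄) →
      Relator ((h F ⊝ h (F ∨̄ proj₁ G)) ⊗ (h G ⊝ h (F ∨̄ proj₁ G)))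
    rel-sq    : (a : Flat) (at : Atom a) → Relator (h (atom a at) ⊗ h (atom a at))
    rel-atom  : (a : Flat) (at : Atom a) (F : L̄) →
      Relator ((h (atom a at) ⊗ h F) ⊝ (h (atom a at) ⊗ h (F ∨̄ a)))

  infix 4 _≈_
  _≈_ : Poly L̄ → Poly L̄ → Set
  _≈_ = Cong Relator

  𝟘 : Poly L̄
  𝟘 = con (ℤ.pos 0)

  monomial : List L̄ → Poly L̄
  monomial = foldr (λ v acc → h v ⊗ acc) (con (ℤ.pos 1))

  lincomb : List (ℤ × List L̄) → Poly L̄
  lincomb = foldr (λ t acc → (con (proj₁ t) ⊗ monomial (proj₂ t)) ⊕ acc) 𝟘

  InPart : Flat → Poly L̄ → Set
  InPart F x = Σ (List (ℤ × List L̄)) λ ts →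
    All (λ t → joinW (proj₂ t) ≡ F) ts × x ≈ lincomb ts

  sumFlats : (Flat → Poly L̄) → Poly L̄
  sumFlats y = foldr (λ F acc → y F ⊕ acc) 𝟘 flats

  IsDirectSumDecomposition : Set
  IsDirectSumDecomposition =
    ((x : Poly L̄) → Σ (Flat → Poly L̄) λ y →
        (∀ F → InPart F (y F)) × x ≈ sumFlats y)
    × ((y : Flat → Poly L̄) → (∀ F → InPart F (y F)) →
        sumFlats y ≈ 𝟘 → ∀ F → y F ≈ 𝟘)

{-# OPTIONS --safe #-}
module Submission where

-- Expanding and collecting terms writes every element as a ℤ-combination of monomials, and
-- grouping the monomials by their join gives a decomposition. For uniqueness, fix a flat X
-- and substitute h_G ↦ h_G for G ≤ X and h_G ↦ 0 otherwise. Since the flats below X are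
-- closed under joins, this respects the defining relations; it fixes A(M)_F when F ≤ X and
-- kills it otherwise. Applied to Σ_F y_F = 0 it gives Σ_{F ≤ X} y_F = 0, so y_X = 0 by
-- well-founded induction on X.

open import Defs
open import Level using (0ℓ)
open import Function using (_∘_)
open import Data.Bool using (true; false; if_then_else_)
open import Data.Nat as ℕ using (ℕ; z≤n; s≤s)
open import Data.Nat.Properties using (m≤n⇒m≤1+n)
open import Data.Nat.Induction using (<-wellFounded)
open import Data.Integer as ℤ using (ℤ)
import Data.Integer.Properties as ℤ
open import Data.Product using (Σ; _×_; _,_; proj₁; proj₂)
open import Data.Sum using (inj₁; inj₂)
open import Data.Empty using (⊥-elim)
open import Data.List using (List; []; _∷_; foldr; _++_; map; filter; length)
open import Data.List.Membership.Propositional using (_∈_)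
open import Data.List.Relation.Unary.Any as Any using (Any; here; there)
open import Data.List.Relation.Unary.All as All using (All; []; _∷_)
open import Data.List.Relation.Unary.All.Properties using (all-filter)
open import Data.List.Relation.Unary.Unique.Propositional using (Unique)
open import Data.List.Relation.Unary.AllPairs using (_∷_)
open import Relation.Nullary using (¬_; Dec; yes; no; does; contradiction)
open import Relation.Nullary.Decidable using (dec-true; dec-false; toSum)
open import Relation.Unary using (Pred; Decidable)
open import Relation.Binary.PropositionalEquality as ≡ using (_≡_; _≢_; refl)
open import Relation.Binary.Definitions using (DecidableEquality)
open import Relation.Binary.Structures using (IsEquivalence)
open import Relation.Binary.Bundles using (Setoid)
import Relation.Binary.Construct.On as On
open import Relation.Binary.Lattice.Structures using (IsLattice)
open import Relation.Binary.Lattice.Bundles using (JoinSemilattice)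
open import Relation.Binary.Lattice.Properties.JoinSemilattice using (≈-dec⇒≤-dec)
open import Induction.WellFounded using (WellFounded; module Subrelation; module All)
open import Algebra.Bundles using (CommutativeRing)
open import Algebra.Consequences.Setoid using (comm∧idˡ⇒id; comm∧invˡ⇒inv; comm∧distrˡ⇒distr)

module _ {A : Set} {P Q : Pred A 0ℓ} (P? : Decidable P) (Q? : Decidable Q)
         (P⇒Q : ∀ {x} → P x → Q x) where

  length-filter-mono : ∀ xs → length (filter P? xs) ℕ.≤ length (filter Q? xs)
  length-filter-mono []       = z≤n
  length-filter-mono (x ∷ xs) with P? x | Q? x
  ... | yes _ | yes _  = s≤s (length-filter-mono xs)
  ... | yes p | no ¬q  = contradiction (P⇒Q p) ¬q
  ... | no _  | yes _  = m≤n⇒m≤1+n (length-filter-mono xs)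
  ... | no _  | no _   = length-filter-mono xs

  length-filter-strictMono : ∀ {xs} → Any (λ x → Q x × ¬ P x) xs →
                             length (filter P? xs) ℕ.< length (filter Q? xs)
  length-filter-strictMono {x ∷ xs} (here (q , ¬p)) with P? x | Q? x
  ... | yes p | _      = contradiction p ¬p
  ... | no _  | yes _  = s≤s (length-filter-mono xs)
  ... | no _  | no ¬q  = contradiction q ¬q
  length-filter-strictMono {x ∷ xs} (there any) with P? x | Q? x
  ... | yes _ | yes _  = s≤s (length-filter-strictMono any)
  ... | yes p | no ¬q  = contradiction (P⇒Q p) ¬q
  ... | no _  | yes _  = m≤n⇒m≤1+n (length-filter-strictMono any)
  ... | no _  | no _   = length-filter-strictMono any

-- Variable-generic versions of AugmentedChow.monomial, .lincomb and .sumFlats; they agree with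
-- those definitionally, so facts about them apply to InPart and IsDirectSumDecomposition.

𝟘 𝟙 : {V : Set} → Poly V
𝟘 = con (ℤ.+ 0)
𝟙 = con (ℤ.+ 1)

monomial : {V : Set} → List V → Poly V
monomial = foldr (λ v acc → var v ⊗ acc) 𝟙

Term : Set → Set
Term V = ℤ × List V

term : {V : Set} → Term V → Poly V
term (c , w) = con c ⊗ monomial w

lincomb : {V : Set} → List (Term V) → Poly V
lincomb = foldr (λ t acc → term t ⊕ acc) 𝟘

sumOver : {V K : Set} → List K → (K → Poly V) → Poly V
sumOver ks f = foldr (λ k acc → f k ⊕ acc) 𝟘 ks

sub : {V W : Set} → (V → Poly W) → Poly V → Poly W
sub τ (var v) = τ v
sub τ (con n) = con n
sub τ (p ⊕ q) = sub τ p ⊕ sub τ q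
sub τ (p ⊗ q) = sub τ p ⊗ sub τ q
sub τ (⊖ p)   = ⊖ sub τ p

sub-sumOver : ∀ {V W K : Set} (τ : V → Poly W) (ks : List K) f →
              sub τ (sumOver ks f) ≡ sumOver ks (sub τ ∘ f)
sub-sumOver τ []       f = refl
sub-sumOver τ (k ∷ ks) f = ≡.cong (sub τ (f k) ⊕_) (sub-sumOver τ ks f)

sub-cong : ∀ {V W : Set} {R : Pred (Poly V) 0ℓ} {S : Pred (Poly W) 0ℓ} (τ : V → Poly W) →
           (∀ {r} → R r → Cong S (sub τ r) 𝟘) →
           ∀ {p q} → Cong R p q → Cong S (sub τ p) (sub τ q)
sub-cong τ kills ≈-refl            = ≈-refl
sub-cong τ kills (≈-sym e)         = ≈-sym (sub-cong τ kills e)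
sub-cong τ kills (≈-trans e e′)    = ≈-trans (sub-cong τ kills e) (sub-cong τ kills e′)
sub-cong τ kills (⊕-cong e e′)     = ⊕-cong (sub-cong τ kills e) (sub-cong τ kills e′)
sub-cong τ kills (⊗-cong e e′)     = ⊗-cong (sub-cong τ kills e) (sub-cong τ kills e′)
sub-cong τ kills (⊖-cong e)        = ⊖-cong (sub-cong τ kills e)
sub-cong τ kills (⊕-assoc p q r)   = ⊕-assoc _ _ _
sub-cong τ kills (⊕-comm p q)      = ⊕-comm _ _
sub-cong τ kills (⊕-idˡ p)         = ⊕-idˡ _
sub-cong τ kills (⊖-invˡ p)        = ⊖-invˡ _
sub-cong τ kills (⊗-assoc p q r)   = ⊗-assoc _ _ _
sub-cong τ kills (⊗-comm p q)      = ⊗-comm _ _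
sub-cong τ kills (⊗-idˡ p)         = ⊗-idˡ _
sub-cong τ kills (distribˡ p q r)  = distribˡ _ _ _
sub-cong τ kills (con-+ m n)       = con-+ m n
sub-cong τ kills (con-* m n)       = con-* m n
sub-cong τ kills (relator r)       = kills r

module Presentation {V : Set} (R : Pred (Poly V) 0ℓ) where

  infix 4 _≈_
  _≈_ : Poly V → Poly V → Set
  _≈_ = Cong R

  ring : CommutativeRing 0ℓ 0ℓ
  ring = record
    { Carrier = Poly V ; _≈_ = _≈_ ; _+_ = _⊕_ ; _*_ = _⊗_ ; -_ = ⊖_ ; 0# = 𝟘 ; 1# = 𝟙
    ; isCommutativeRing = record
      { isRing = record
        { +-isAbelianGroup = record
          { isGroup = record
            { isMonoid = record
              { isSemigroup = record
                { isMagma = record { isEquivalence = isEquivalence ; ∙-cong = ⊕-cong }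
                ; assoc = ⊕-assoc }
              ; identity = comm∧idˡ⇒id setoid ⊕-comm ⊕-idˡ }
            ; inverse = comm∧invˡ⇒inv setoid ⊕-comm ⊖-invˡ
            ; ⁻¹-cong = ⊖-cong }
          ; comm = ⊕-comm }
        ; *-cong = ⊗-cong
        ; *-assoc = ⊗-assoc
        ; *-identity = comm∧idˡ⇒id setoid ⊗-comm ⊗-idˡ
        ; distrib = comm∧distrˡ⇒distr setoid ⊕-cong ⊗-comm distribˡ }
      ; *-comm = ⊗-comm } }
    where
    isEquivalence : IsEquivalence _≈_
    isEquivalence = record { refl = ≈-refl ; sym = ≈-sym ; trans = ≈-trans }
    setoid : Setoid 0ℓ 0ℓ
    setoid = record { isEquivalence = isEquivalence }

  open CommutativeRing ring public
    using (setoid; reflexive; zeroˡ; zeroʳ; distribʳ; +-identityʳ; *-identityʳ)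
  open CommutativeRing ring
    using (-‿inverseʳ; +-group; +-abelianGroup; +-commutativeSemigroup; *-commutativeSemigroup)
  open import Algebra.Properties.Group +-group using (inverseˡ-unique; ε⁻¹≈ε)
  open import Algebra.Properties.AbelianGroup +-abelianGroup using (⁻¹-∙-comm)
  open import Algebra.Properties.CommutativeSemigroup +-commutativeSemigroup
    using () renaming (interchange to +-interchange)
  open import Algebra.Properties.CommutativeSemigroup *-commutativeSemigroup
    using () renaming (interchange to *-interchange)
  open import Algebra.Properties.Ring (CommutativeRing.ring ring) using (-‿distribˡ-*)
  open import Relation.Binary.Reasoning.Setoid setoid public

  con-neg : ∀ c → con (ℤ.- c) ≈ ⊖ con c
  con-neg c = inverseˡ-unique _ _ (begin
    con (ℤ.- c) ⊕ con c  ≈⟨ con-+ (ℤ.- c) c ⟨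
    con (ℤ.- c ℤ.+ c)    ≡⟨ ≡.cong con (ℤ.+-inverseˡ c) ⟩
    𝟘                    ∎)

  𝟘⊝𝟘 : ∀ {x y} → x ≈ 𝟘 → y ≈ 𝟘 → x ⊝ y ≈ 𝟘
  𝟘⊝𝟘 x≈0 y≈0 = ≈-trans (⊕-cong x≈0 (⊖-cong y≈0)) (-‿inverseʳ 𝟘)

  monomial-++ : ∀ u w → monomial (u ++ w) ≈ monomial u ⊗ monomial w
  monomial-++ []      w = ≈-sym (⊗-idˡ _)
  monomial-++ (v ∷ u) w = ≈-trans (⊗-cong ≈-refl (monomial-++ u w)) (≈-sym (⊗-assoc _ _ _))

  lincomb-++ : ∀ ts us → lincomb (ts ++ us) ≈ lincomb ts ⊕ lincomb us
  lincomb-++ []       us = ≈-sym (⊕-idˡ _)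
  lincomb-++ (t ∷ ts) us = ≈-trans (⊕-cong ≈-refl (lincomb-++ ts us)) (≈-sym (⊕-assoc _ _ _))

  negate : List (Term V) → List (Term V)
  negate = map (λ (c , w) → ℤ.- c , w)

  lincomb-negate : ∀ ts → lincomb (negate ts) ≈ ⊖ lincomb ts
  lincomb-negate []             = ≈-sym ε⁻¹≈ε
  lincomb-negate ((c , w) ∷ ts) = begin
    con (ℤ.- c) ⊗ monomial w ⊕ lincomb (negate ts)
      ≈⟨ ⊕-cong (⊗-cong (con-neg c) ≈-refl) (lincomb-negate ts) ⟩
    ⊖ con c ⊗ monomial w ⊕ ⊖ lincomb ts  ≈⟨ ⊕-cong (-‿distribˡ-* _ _) ≈-refl ⟨
    ⊖ term (c , w) ⊕ ⊖ lincomb ts        ≈⟨ ⁻¹-∙-comm _ _ ⟩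
    ⊖ (term (c , w) ⊕ lincomb ts)        ∎

  scale : Term V → List (Term V) → List (Term V)
  scale (c , u) = map (λ (d , w) → c ℤ.* d , u ++ w)

  lincomb-scale : ∀ t us → lincomb (scale t us) ≈ term t ⊗ lincomb us
  lincomb-scale t         []             = ≈-sym (zeroʳ _)
  lincomb-scale t@(c , u) ((d , w) ∷ us) = begin
    con (c ℤ.* d) ⊗ monomial (u ++ w) ⊕ lincomb (scale t us)
      ≈⟨ ⊕-cong (⊗-cong (con-* c d) (monomial-++ u w)) (lincomb-scale t us) ⟩
    (con c ⊗ con d) ⊗ (monomial u ⊗ monomial w) ⊕ term t ⊗ lincomb us
      ≈⟨ ⊕-cong (*-interchange _ _ _ _) ≈-refl ⟩
    term t ⊗ term (d , w) ⊕ term t ⊗ lincomb us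
      ≈⟨ distribˡ _ _ _ ⟨
    term t ⊗ lincomb ((d , w) ∷ us) ∎

  multiply : List (Term V) → List (Term V) → List (Term V)
  multiply []       us = []
  multiply (t ∷ ts) us = scale t us ++ multiply ts us

  lincomb-multiply : ∀ ts us → lincomb (multiply ts us) ≈ lincomb ts ⊗ lincomb us
  lincomb-multiply []       us = ≈-sym (zeroˡ _)
  lincomb-multiply (t ∷ ts) us = begin
    lincomb (scale t us ++ multiply ts us)
      ≈⟨ lincomb-++ (scale t us) (multiply ts us) ⟩
    lincomb (scale t us) ⊕ lincomb (multiply ts us)
      ≈⟨ ⊕-cong (lincomb-scale t us) (lincomb-multiply ts us) ⟩
    term t ⊗ lincomb us ⊕ lincomb ts ⊗ lincomb us
      ≈⟨ distribʳ _ _ _ ⟨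
    (term t ⊕ lincomb ts) ⊗ lincomb us ∎

  normalForm : Poly V → List (Term V)
  normalForm (var v) = (ℤ.+ 1 , v ∷ []) ∷ []
  normalForm (con c) = (c , []) ∷ []
  normalForm (p ⊕ q) = normalForm p ++ normalForm q
  normalForm (p ⊗ q) = multiply (normalForm p) (normalForm q)
  normalForm (⊖ p)   = negate (normalForm p)

  lincomb-normalForm : ∀ p → lincomb (normalForm p) ≈ p
  lincomb-normalForm (var v) = ≈-trans (+-identityʳ _) (≈-trans (⊗-idˡ _) (*-identityʳ _))
  lincomb-normalForm (con c) = ≈-trans (+-identityʳ _) (*-identityʳ _)
  lincomb-normalForm (p ⊕ q) = ≈-trans (lincomb-++ (normalForm p) (normalForm q))
                                       (⊕-cong (lincomb-normalForm p) (lincomb-normalForm q))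
  lincomb-normalForm (p ⊗ q) = ≈-trans (lincomb-multiply (normalForm p) (normalForm q))
                                       (⊗-cong (lincomb-normalForm p) (lincomb-normalForm q))
  lincomb-normalForm (⊖ p)   = ≈-trans (lincomb-negate (normalForm p)) (⊖-cong (lincomb-normalForm p))

  module _ {K : Set} where

    sumOver-cong : ∀ ks {f g : K → Poly V} → (∀ k → f k ≈ g k) → sumOver ks f ≈ sumOver ks g
    sumOver-cong []       f≈g = ≈-refl
    sumOver-cong (k ∷ ks) f≈g = ⊕-cong (f≈g k) (sumOver-cong ks f≈g)

    sumOver-+ : ∀ ks (f g : K → Poly V) → sumOver ks (λ k → f k ⊕ g k) ≈ sumOver ks f ⊕ sumOver ks g
    sumOver-+ []       f g = ≈-sym (⊕-idˡ _)
    sumOver-+ (k ∷ ks) f g = ≈-trans (⊕-cong ≈-refl (sumOver-+ ks f g)) (+-interchange _ _ _ _)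

    sumOver-zero : ∀ {ks} {f : K → Poly V} → All (λ k → f k ≈ 𝟘) ks → sumOver ks f ≈ 𝟘
    sumOver-zero []          = ≈-refl
    sumOver-zero (fk≈0 ∷ f≈0) = ≈-trans (⊕-cong fk≈0 (sumOver-zero f≈0)) (⊕-idˡ _)

    sumOver-single : ∀ {ks k} {f : K → Poly V} → Unique ks → k ∈ ks →
                     (∀ j → j ≢ k → f j ≈ 𝟘) → sumOver ks f ≈ f k
    sumOver-single (k∉ks ∷ _) (here refl) off =
      ≈-trans (⊕-cong ≈-refl (sumOver-zero (All.map (λ k≢j → off _ (k≢j ∘ ≡.sym)) k∉ks))) (+-identityʳ _)
    sumOver-single (j∉ks ∷ unique) (there k∈ks) off =
      ≈-trans (⊕-cong (off _ λ { refl → All.lookup j∉ks k∈ks refl }) (sumOver-single unique k∈ks off))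
              (⊕-idˡ _)

    module _ (_≟_ : DecidableEquality K) where

      sumOver-indicator : ∀ {ks k} x → Unique ks → k ∈ ks →
                          sumOver ks (λ j → if does (k ≟ j) then x else 𝟘) ≈ x
      sumOver-indicator {k = k} x unique k∈ks =
        ≈-trans (sumOver-single unique k∈ks off)
                (reflexive (≡.cong (if_then x else 𝟘) (dec-true (k ≟ k) refl)))
        where
        off : ∀ j → j ≢ k → (if does (k ≟ j) then x else 𝟘) ≈ 𝟘
        off j j≢k = reflexive (≡.cong (if_then x else 𝟘) (dec-false (k ≟ j) (j≢k ∘ ≡.sym)))

      lincomb-filter-∷ : ∀ (key : Term V → K) k t ts →
        lincomb (filter (λ s → key s ≟ k) (t ∷ ts)) ≈
        (if does (key t ≟ k) then term t else 𝟘) ⊕ lincomb (filter (λ s → key s ≟ k) ts)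
      lincomb-filter-∷ key k t ts with does (key t ≟ k)
      ... | true  = ≈-refl
      ... | false = ≈-sym (⊕-idˡ _)

      lincomb-partition : ∀ (key : Term V → K) {ks} → Unique ks → (∀ k → k ∈ ks) → ∀ ts →
                          lincomb ts ≈ sumOver ks (λ k → lincomb (filter (λ t → key t ≟ k) ts))
      lincomb-partition key {ks} unique complete [] = ≈-sym (sumOver-zero (All.universal (λ _ → ≈-refl) ks))
      lincomb-partition key {ks} unique complete (t ∷ ts) = begin
        term t ⊕ lincomb ts
          ≈⟨ ⊕-cong (sumOver-indicator (term t) unique (complete (key t)))
                    (≈-sym (lincomb-partition key unique complete ts)) ⟨
        sumOver ks (λ k → if does (key t ≟ k) then term t else 𝟘) ⊕ sumOver ks (λ k → component k ts)
          ≈⟨ sumOver-+ ks _ _ ⟨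
        sumOver ks (λ k → (if does (key t ≟ k) then term t else 𝟘) ⊕ component k ts)
          ≈⟨ sumOver-cong ks (λ k → lincomb-filter-∷ key k t ts) ⟨
        sumOver ks (λ k → component k (t ∷ ts)) ∎
        where
        component : K → List (Term V) → Poly V
        component k = lincomb ∘ filter (λ t → key t ≟ k)

  module Truncation {P : Pred V 0ℓ} (P? : Decidable P) where

    truncate : V → Poly V
    truncate v = if does (P? v) then var v else 𝟘

    kept : ∀ {v} → P v → truncate v ≡ var v
    kept {v} p = ≡.cong (if_then var v else 𝟘) (dec-true (P? v) p)

    dropped : ∀ {v} → ¬ P v → truncate v ≡ 𝟘
    dropped {v} ¬p = ≡.cong (if_then var v else 𝟘) (dec-false (P? v) ¬p)

    truncate-monomial : ∀ {w} → All P w → sub truncate (monomial w) ≈ monomial w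
    truncate-monomial []       = ≈-refl
    truncate-monomial (p ∷ ps) = ⊗-cong (reflexive (kept p)) (truncate-monomial ps)

    truncate-monomial-zero : ∀ {w} → ¬ All P w → sub truncate (monomial w) ≈ 𝟘
    truncate-monomial-zero {[]}    ¬all = ⊥-elim (¬all [])
    truncate-monomial-zero {v ∷ w} ¬all with P? v
    ... | yes p = ≈-trans (⊗-cong ≈-refl (truncate-monomial-zero (¬all ∘ (p ∷_)))) (zeroʳ _)
    ... | no ¬p = zeroˡ _

    truncate-lincomb : ∀ {ts} → All (All P ∘ proj₂) ts → sub truncate (lincomb ts) ≈ lincomb ts
    truncate-lincomb []       = ≈-refl
    truncate-lincomb (p ∷ ps) = ⊕-cong (⊗-cong ≈-refl (truncate-monomial p)) (truncate-lincomb ps)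

    truncate-lincomb-zero : ∀ {ts} → All (¬_ ∘ All P ∘ proj₂) ts → sub truncate (lincomb ts) ≈ 𝟘
    truncate-lincomb-zero []         = ≈-refl
    truncate-lincomb-zero (¬p ∷ ¬ps) =
      ≈-trans (⊕-cong (≈-trans (⊗-cong ≈-refl (truncate-monomial-zero ¬p)) (zeroʳ _))
                      (truncate-lincomb-zero ¬ps))
              (⊕-idˡ _)

module DirectSum (M : Matroid) where

  open Matroid M
  open AugmentedChow M using (Relator; rel-join; rel-sq; rel-atom; InPart)
  open Presentation Relator
  open IsLattice isLattice using (x≤x∨y; y≤x∨y; ∨-least)
    renaming (refl to ≤-refl; trans to ≤-trans; antisym to ≤-antisym)

  private
    joinSemilattice : JoinSemilattice 0ℓ 0ℓ 0ℓ
    joinSemilattice = record { isJoinSemilattice = IsLattice.isJoinSemilattice isLattice }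

  _≤?_ : ∀ F G → Dec (F ≤ G)
  _≤?_ = ≈-dec⇒≤-dec joinSemilattice _≟_

  joinW-upper : ∀ {w X} → joinW w ≤ X → All (λ v → proj₁ v ≤ X) w
  joinW-upper {[]}    _     = []
  joinW-upper {v ∷ w} vw≤X = ≤-trans (x≤x∨y _ _) vw≤X ∷ joinW-upper (≤-trans (y≤x∨y _ _) vw≤X)

  joinW-least : ∀ {w X} → All (λ v → proj₁ v ≤ X) w → joinW w ≤ X
  joinW-least {X = X} []     = ∅-minimum X
  joinW-least (v≤X ∷ w≤X)    = ∨-least v≤X (joinW-least w≤X)

  module Below (X : Flat) = Truncation (λ (v : L̄) → proj₁ v ≤? X)

  π : Flat → L̄ → Poly L̄
  π = Below.truncate

  module _ (X : Flat) where

    π-kept : ∀ {v} → proj₁ v ≤ X → π X v ≈ var v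
    π-kept = reflexive ∘ Below.kept X

    π-dropped : ∀ {v} → ¬ proj₁ v ≤ X → π X v ≈ 𝟘
    π-dropped = reflexive ∘ Below.dropped X

    π-dropped-⊗ˡ : ∀ {v} y → ¬ proj₁ v ≤ X → π X v ⊗ y ≈ 𝟘
    π-dropped-⊗ˡ y v≰X = ≈-trans (⊗-cong (π-dropped v≰X) ≈-refl) (zeroˡ y)

    π-dropped-⊗ʳ : ∀ {v} x → ¬ proj₁ v ≤ X → x ⊗ π X v ≈ 𝟘
    π-dropped-⊗ʳ x v≰X = ≈-trans (⊗-cong ≈-refl (π-dropped v≰X)) (zeroʳ x)

    -- Splitting on `toSum (G ≤? X)` rather than on `G ≤? X` keeps `with` from abstracting the
    -- test inside the unfolded `π X`, so that π-kept and π-dropped still apply.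
    π-kills-relators : ∀ {r} → Relator r → sub (π X) r ≈ 𝟘
    π-kills-relators (rel-join F G) with toSum (proj₁ (F ∨̄ proj₁ G) ≤? X) | toSum (proj₁ F ≤? X)
    ... | inj₁ F∨G≤X | _ = ≈-trans
      (⊗-cong (⊕-cong (π-kept (≤-trans (x≤x∨y _ _) F∨G≤X)) (⊖-cong (π-kept F∨G≤X)))
              (⊕-cong (π-kept (≤-trans (y≤x∨y _ _) F∨G≤X)) (⊖-cong (π-kept F∨G≤X))))
      (relator (rel-join F G))
    ... | inj₂ F∨G≰X | inj₂ F≰X =
      ≈-trans (⊗-cong (𝟘⊝𝟘 (π-dropped F≰X) (π-dropped F∨G≰X)) ≈-refl) (zeroˡ _)
    ... | inj₂ F∨G≰X | inj₁ F≤X =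
      ≈-trans (⊗-cong ≈-refl (𝟘⊝𝟘 (π-dropped (F∨G≰X ∘ ∨-least F≤X)) (π-dropped F∨G≰X))) (zeroʳ _)
    π-kills-relators (rel-sq a at) with toSum (a ≤? X)
    ... | inj₁ a≤X = ≈-trans (⊗-cong (π-kept a≤X) (π-kept a≤X)) (relator (rel-sq a at))
    ... | inj₂ a≰X = π-dropped-⊗ˡ _ a≰X
    π-kills-relators (rel-atom a at F) with toSum (a ≤? X) | toSum (proj₁ F ≤? X)
    ... | inj₂ a≰X | _ = 𝟘⊝𝟘 (π-dropped-⊗ˡ _ a≰X) (π-dropped-⊗ˡ _ a≰X)
    ... | inj₁ a≤X | inj₁ F≤X = ≈-trans
      (⊕-cong (⊗-cong (π-kept a≤X) (π-kept F≤X)) (⊖-cong (⊗-cong (π-kept a≤X) (π-kept (∨-least F≤X a≤X)))))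
      (relator (rel-atom a at F))
    ... | inj₁ a≤X | inj₂ F≰X =
      𝟘⊝𝟘 (π-dropped-⊗ʳ _ F≰X) (π-dropped-⊗ʳ _ (F≰X ∘ ≤-trans (x≤x∨y _ _)))

  π-cong : ∀ X {x y} → x ≈ y → sub (π X) x ≈ sub (π X) y
  π-cong X = sub-cong (π X) (π-kills-relators X)

  π-fixes-part : ∀ {F X y} → InPart F y → F ≤ X → sub (π X) y ≈ y
  π-fixes-part {F} {X} {y} (ts , joins≡F , y≈ts) F≤X = begin
    sub (π X) y            ≈⟨ π-cong X y≈ts ⟩
    sub (π X) (lincomb ts) ≈⟨ Below.truncate-lincomb X (All.map (λ {t} → below {t}) joins≡F) ⟩
    lincomb ts             ≈⟨ y≈ts ⟨
    y                      ∎
    where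
    below : ∀ {t : Term L̄} → joinW (proj₂ t) ≡ F → All (λ v → proj₁ v ≤ X) (proj₂ t)
    below refl = joinW-upper F≤X

  π-kills-part : ∀ {F X y} → InPart F y → ¬ F ≤ X → sub (π X) y ≈ 𝟘
  π-kills-part {F} {X} (ts , joins≡F , y≈ts) F≰X =
    ≈-trans (π-cong X y≈ts) (Below.truncate-lincomb-zero X (All.map (λ {t} → notBelow {t}) joins≡F))
    where
    notBelow : ∀ {t : Term L̄} → joinW (proj₂ t) ≡ F → ¬ All (λ v → proj₁ v ≤ X) (proj₂ t)
    notBelow refl = F≰X ∘ joinW-least

  infix 4 _⊂_
  _⊂_ : Flat → Flat → Set
  F ⊂ G = F ≤ G × F ≢ G

  ⊂-wellFounded : WellFounded _⊂_
  ⊂-wellFounded = Subrelation.wellFounded ⊂⇒#below< (On.wellFounded #below <-wellFounded)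
    where
    #below : Flat → ℕ
    #below X = length (filter (_≤? X) flats)

    ⊂⇒#below< : ∀ {F G} → F ⊂ G → #below F ℕ.< #below G
    ⊂⇒#below< {F} {G} (F≤G , F≢G) =
      length-filter-strictMono (_≤? F) (_≤? G) (λ H≤F → ≤-trans H≤F F≤G)
        (Any.map (λ { refl → ≤-refl , λ G≤F → F≢G (≤-antisym F≤G G≤F) }) (flats-complete G))

  decomposition : ∀ x → Σ (Flat → Poly L̄) λ y → (∀ F → InPart F (y F)) × x ≈ sumOver flats y
  decomposition x = part , (λ F → terms F , all-filter (joinOf≟ F) (normalForm x) , ≈-refl) , (begin
    x
      ≈⟨ lincomb-normalForm x ⟨
    lincomb (normalForm x)
      ≈⟨ lincomb-partition _≟_ (joinW ∘ proj₂) flats-unique flats-complete (normalForm x) ⟩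
    sumOver flats part ∎)
    where
    joinOf≟ : ∀ F (t : Term L̄) → Dec (joinW (proj₂ t) ≡ F)
    joinOf≟ F t = joinW (proj₂ t) ≟ F

    terms : Flat → List (Term L̄)
    terms F = filter (joinOf≟ F) (normalForm x)

    part : Flat → Poly L̄
    part = lincomb ∘ terms

  decomposition-unique : ∀ (y : Flat → Poly L̄) → (∀ F → InPart F (y F)) →
                         sumOver flats y ≈ 𝟘 → ∀ F → y F ≈ 𝟘
  decomposition-unique y parts Σy≈0 = All.wfRec ⊂-wellFounded _ (λ X → y X ≈ 𝟘) vanishes
    where
    vanishes : ∀ X → (∀ {F} → F ⊂ X → y F ≈ 𝟘) → y X ≈ 𝟘
    vanishes X ih = begin
      y X                             ≈⟨ π-fixes-part (parts X) ≤-refl ⟨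
      sub (π X) (y X)                 ≈⟨ sumOver-single flats-unique (flats-complete X) offDiagonal ⟨
      sumOver flats (sub (π X) ∘ y)   ≡⟨ sub-sumOver (π X) flats y ⟨
      sub (π X) (sumOver flats y)     ≈⟨ π-cong X Σy≈0 ⟩
      𝟘                               ∎
      where
      offDiagonal : ∀ F → F ≢ X → sub (π X) (y F) ≈ 𝟘
      offDiagonal F F≢X with F ≤? X
      ... | yes F≤X = ≈-trans (π-fixes-part (parts F) F≤X) (ih (F≤X , F≢X))
      ... | no F≰X  = π-kills-part (parts F) F≰X

proposition3p1 : (M : Matroid) → AugmentedChow.IsDirectSumDecomposition M
proposition3p1 M = decomposition , decomposition-unique
  where open DirectSum M
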